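{- Let $G$ be a $K_4$-free graph and let $A,B\subseteq V(G)$ be disjoint cliques of size $3$. Then ${\rm ext}_G(A,B)\leq 15$.
   Context: All graphs are finite and simple. An orientation is $K^\circlearrowright_3$-free if it contains no cyclically oriented triangle. For a graph $G$, $\mathcal{D}(G)$ denotes the set of $K^\circlearrowright_3$-free orientations of $G$. Orientations $\vec S,\vec T$ of disjoint edge sets are compatible if $\vec S\cup\vec T$ is $K^\circlearrowright_3$-free. For disjoint $A,B\subseteq V(G)$, $G[A,B]$ denotes the graph with the edges of $G$ between $A$ and $B$, and with $T=G[A]\cup G[B]$, ${\rm ext}_G(A,B)=\max_{\vec T\in\mathcal{D}(T)}|\{\vec S\in\mathcal{D}(G[A,B])\colon \vec S\text{ and }\vec T\text{ compatible}\}|$. -}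

module Defs where

open import Data.Nat using (ℕ; zero; suc; _⊔_)
open import Data.Bool using (Bool; true; false; _∧_; _∨_; not; if_then_else_)
open import Data.Fin using (Fin)
open import Data.Fin.Subset using (Subset; _∈_; ∣_∣)
open import Data.Vec using (lookup)
open import Data.Vec.Functional using () renaming (_∷_ to _∷ᶠ_)
open import Data.List using (List; []; _∷_; concatMap; map; filter; length; foldr; allFin)
open import Data.Bool.ListAction using (all; any)
open import Data.Empty using (⊥)
open import Data.Product using (_×_)
open import Relation.Binary.PropositionalEquality using (_≡_; _≢_)
open import Relation.Nullary using (¬_)
open import Data.Bool using (T)
open import Relation.Nullary.Decidable using (T?)

record Graph (n : ℕ) : Set where
  field
    adj    : Fin n → Fin n → Bool
    sym    : ∀ u v → adj u v ≡ adj v u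
    irrefl : ∀ u → adj u u ≡ false
open Graph public

EdgeSet : ℕ → Set
EdgeSet n = Fin n → Fin n → Bool

-- An orientation candidate: D u v = true means the arc u → v.
Arcs : ℕ → Set
Arcs n = Fin n → Fin n → Bool

∀ᵇ : ∀ {n} → (Fin n → Bool) → Bool
∀ᵇ p = all p (allFin _)

∃ᵇ : ∀ {n} → (Fin n → Bool) → Bool
∃ᵇ p = any p (allFin _)

_⇒ᵇ_ : Bool → Bool → Bool
a ⇒ᵇ b = not a ∨ b

_xorᵇ_ : Bool → Bool → Bool
a xorᵇ b = if a then not b else b

isOrientation : ∀ {n} → EdgeSet n → Arcs n → Bool
isOrientation H D =
  ∀ᵇ λ u → ∀ᵇ λ v → (D u v ⇒ᵇ H u v) ∧ (H u v ⇒ᵇ (D u v xorᵇ D v u))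

hasCyclicTriangle : ∀ {n} → Arcs n → Bool
hasCyclicTriangle D = ∃ᵇ λ u → ∃ᵇ λ v → ∃ᵇ λ w → D u v ∧ D v w ∧ D w u

inD : ∀ {n} → EdgeSet n → Arcs n → Bool
inD H D = isOrientation H D ∧ not (hasCyclicTriangle D)

_∪ᵃ_ : ∀ {n} → Arcs n → Arcs n → Arcs n
(S ∪ᵃ T) u v = S u v ∨ T u v

compatible : ∀ {n} → Arcs n → Arcs n → Bool
compatible S T = not (hasCyclicTriangle (S ∪ᵃ T))

allFunsTo : ∀ {A : Set} → List A → (n : ℕ) → List (Fin n → A)
allFunsTo xs zero    = (λ ()) ∷ []
allFunsTo xs (suc n) = concatMap (λ f → map (λ a → a ∷ᶠ f) xs) (allFunsTo xs n)

allArcs : (n : ℕ) → List (Arcs n)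
allArcs n = allFunsTo (allFunsTo (true ∷ false ∷ []) n) n

-- All orientations in 𝒟(H), as a list without repetitions.
𝒟 : ∀ {n} → EdgeSet n → List (Arcs n)
𝒟 {n} H = filter (λ D → T? (inD H D)) (allArcs n)

mem : ∀ {n} → Subset n → Fin n → Bool
mem A u = lookup A u

between : ∀ {n} → Graph n → Subset n → Subset n → EdgeSet n
between G A B u v =
  adj G u v ∧ ((mem A u ∧ mem B v) ∨ (mem B u ∧ mem A v))

inside : ∀ {n} → Graph n → Subset n → Subset n → EdgeSet n
inside G A B u v =
  adj G u v ∧ ((mem A u ∧ mem A v) ∨ (mem B u ∧ mem B v))

numCompatible : ∀ {n} → Graph n → Subset n → Subset n → Arcs n → ℕ
numCompatible G A B T =
  length (filter (λ S → T? (compatible S T)) (𝒟 (between G A B)))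

ext : ∀ {n} → Graph n → Subset n → Subset n → ℕ
ext G A B = foldr _⊔_ 0 (map (numCompatible G A B) (𝒟 (inside G A B)))

Adj : ∀ {n} → Graph n → Fin n → Fin n → Set
Adj G u v = adj G u v ≡ true

IsClique : ∀ {n} → Graph n → Subset n → Set
IsClique G A = ∀ u v → u ∈ A → v ∈ A → u ≢ v → Adj G u v

K4Free : ∀ {n} → Graph n → Set
K4Free G = ∀ a b c d →
  ¬ (Adj G a b × Adj G a c × Adj G a d × Adj G b c × Adj G b d × Adj G c d)

Disjoint : ∀ {n} → Subset n → Subset n → Set
Disjoint A B = ∀ u → u ∈ A → u ∈ B → ⊥

-- Fix O ∈ 𝒟(G[A] ∪ G[B]). It orients the triangles A and B transitively, say
-- a₀ → a₁ → a₂ and b₀ → b₁ → b₂. An orientation S of G[A,B] compatible with O is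
-- determined by its 3×3 pattern of arcs aᵢ → bⱼ, and that pattern is monotone: for
-- i < k, an arc aₖ → bⱼ forces aᵢ → bⱼ (else aᵢ → aₖ → bⱼ → aᵢ), and an arc aⱼ → bᵢ
-- forces aⱼ → bₖ (else aⱼ → bᵢ → bₖ → aⱼ), whenever the edges involved exist.
-- K₄-freeness means no vertex of one triangle is adjacent to all of the other, and
-- for every such 3×3 edge pattern exhaustive evaluation finds at most 15 monotone
-- arc patterns.

module Submission where

open import Defs hiding (sym)

open import Data.Bool using (Bool; true; false; _∧_; not; T)
open import Data.Bool.Properties using (T-≡; T-∧; T-∨; not-injective)
open import Data.Empty using (⊥; ⊥-elim)
open import Data.Fin using (Fin; zero; suc; toℕ)
open import Data.Fin.Patterns using (0F; 1F; 2F)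
open import Data.Fin.Properties using (suc-injective)
open import Data.Fin.Subset using (Subset; ∣_∣)
open import Data.List using (List; []; _∷_; map; filter; length; allFin; concatMap)
open import Data.List.Properties using (length-map; foldr-preservesᵇ)
open import Data.List.Membership.Propositional using (_∈_)
open import Data.List.Membership.Propositional.Properties
  using (∈-map⁺; ∈-map⁻; ∈-filter⁺; ∈-concatMap⁺)
open import Data.List.Relation.Binary.Subset.Propositional using (_⊆_)
open import Data.List.Relation.Unary.All as All using (All; []; _∷_)
import Data.List.Relation.Unary.All.Properties as AllP
open import Data.List.Relation.Unary.AllPairs as AllPairs using (AllPairs; []; _∷_)
import Data.List.Relation.Unary.AllPairs.Properties as AllPairsP
open import Data.List.Relation.Unary.Any as Any using (here; there)
import Data.List.Relation.Unary.Any.Properties as AnyP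
open import Data.List.Relation.Unary.Unique.Propositional using (Unique)
import Data.List.Relation.Unary.Unique.Propositional.Properties as UniqueP
open import Data.Nat using (ℕ; zero; suc; _≤_; _≤ᵇ_; _<ᵇ_; z≤n; s≤s)
open import Data.Nat.Properties using (≤ᵇ⇒≤; ⊔-lub; ≤-trans; ≤-reflexive; module ≤-Reasoning)
open import Data.Product using (Σ; ∃; _×_; _,_; proj₁; proj₂)
open import Data.Sum using (_⊎_; inj₁; inj₂)
open import Data.Unit using (tt)
open import Data.Vec using (Vec; []; _∷_; lookup; tabulate)
open import Data.Vec.Properties using (lookup∘tabulate; lookup⇒[]=)
open import Data.Vec.Functional using () renaming (_∷_ to _∷ᶠ_)
open import Function using (_∘_; Equivalence)
open import Relation.Binary.PropositionalEquality
  using (_≡_; _≢_; refl; sym; trans; cong; subst; module ≡-Reasoning)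
open import Relation.Nullary using (¬_; Dec; yes; no)
open import Relation.Nullary.Decidable using (T?; decidable-stable)

open Equivalence using (to; from)

⇒ᵇ-elim : ∀ {a b} → T (a ⇒ᵇ b) → T a → T b
⇒ᵇ-elim {true} b _ = b

⇒ᵇ-intro : ∀ {a b} → (T a → T b) → T (a ⇒ᵇ b)
⇒ᵇ-intro {true}  f = f tt
⇒ᵇ-intro {false} _ = tt

not-intro : ∀ {a} → ¬ T a → T (not a)
not-intro {true}  ¬a = ¬a tt
not-intro {false} _  = tt

not-elim : ∀ {a} → T (not a) → ¬ T a
not-elim {false} _ ()

xorᵇ⇒≡not : ∀ {a b} → T (a xorᵇ b) → b ≡ not a
xorᵇ⇒≡not {true}  {false} _ = refl
xorᵇ⇒≡not {false} {true}  _ = refl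

module _ {n} {p : Fin n → Bool} where

  ∀ᵇ-elim : T (∀ᵇ p) → ∀ x → T (p x)
  ∀ᵇ-elim h = AllP.tabulate⁻ (AllP.all⁺ p (allFin n) h)

  ∀ᵇ-intro : (∀ x → T (p x)) → T (∀ᵇ p)
  ∀ᵇ-intro h = AllP.all⁻ p (AllP.tabulate⁺ h)

  ∃ᵇ-intro : ∀ x → T (p x) → T (∃ᵇ p)
  ∃ᵇ-intro x px = AnyP.any⁺ p (AnyP.tabulate⁺ x px)

module _ {X : Set} where

  private
    remove : ∀ {x : X} (ys : List X) → x ∈ ys → List X
    remove (_ ∷ ys) (here _)  = ys
    remove (y ∷ ys) (there m) = y ∷ remove ys m

    length-remove : ∀ {x : X} (ys : List X) (m : x ∈ ys) → length ys ≡ suc (length (remove ys m))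
    length-remove (_ ∷ _)  (here _)  = refl
    length-remove (_ ∷ ys) (there m) = cong suc (length-remove ys m)

    ∈-remove : ∀ {x z : X} {ys : List X} (m : x ∈ ys) → z ∈ ys → x ≢ z → z ∈ remove ys m
    ∈-remove (here refl) (here refl) x≢z = ⊥-elim (x≢z refl)
    ∈-remove (here _)    (there z∈)  _   = z∈
    ∈-remove (there _)   (here refl) _   = here refl
    ∈-remove (there m)   (there z∈)  x≢z = there (∈-remove m z∈ x≢z)

  Unique-⊆⇒length≤ : ∀ {xs ys : List X} → Unique xs → xs ⊆ ys → length xs ≤ length ys
  Unique-⊆⇒length≤ {[]}     _              _      = z≤n
  Unique-⊆⇒length≤ {x ∷ xs} {ys} (x≢xs ∷ u) xs⊆ys =
    ≤-trans (s≤s (Unique-⊆⇒length≤ u xs⊆ys−x)) (≤-reflexive (sym (length-remove ys x∈ys)))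
    where
    x∈ys = xs⊆ys (here refl)
    xs⊆ys−x : xs ⊆ remove ys x∈ys
    xs⊆ys−x z∈ = ∈-remove x∈ys (xs⊆ys (there z∈)) (All.lookup x≢xs z∈)

AllPairs-restrict : ∀ {X : Set} {P : X → Set} {R R′ : X → X → Set} {xs : List X} →
  (∀ {x y} → P x → P y → R x y → R′ x y) → All P xs → AllPairs R xs → AllPairs R′ xs
AllPairs-restrict f []         []         = []
AllPairs-restrict f (px ∷ pxs) (rx ∷ rxs) =
  All.zipWith (λ (py , r) → f px py r) (pxs , rx) ∷ AllPairs-restrict f pxs rxs

-- Patterns only determine an orientation pointwise, which without function
-- extensionality does not contradict S ≢ S′; distinct enumerated functions are
-- therefore separated at an explicit point.
Apart : ∀ {A : Set} {n} → (A → A → Set) → (Fin n → A) → (Fin n → A) → Set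
Apart R f g = ∃ λ i → R (f i) (g i)

allFunsTo-apart : ∀ {A : Set} {R : A → A → Set} {xs : List A} →
                  AllPairs R xs → ∀ n → AllPairs (Apart R) (allFunsTo xs n)
allFunsTo-apart         apart zero    = [] ∷ []
allFunsTo-apart {A} {R} {xs} apart (suc n) =
  AllPairsP.concat⁺ (AllP.map⁺ (All.universal extensions-apart _))
                    (AllPairsP.map⁺ (AllPairs.map extensions-cross (allFunsTo-apart apart n)))
  where
  extensions : (Fin n → A) → List (Fin (suc n) → A)
  extensions f = map (λ a → a ∷ᶠ f) xs
  extensions-apart : ∀ f → AllPairs (Apart R) (extensions f)
  extensions-apart f = AllPairsP.map⁺ (AllPairs.map (zero ,_) apart)
  extensions-cross : ∀ {f g} → Apart R f g →
                     All (λ φ → All (Apart R φ) (extensions g)) (extensions f)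
  extensions-cross (i , r) =
    AllP.map⁺ (All.universal (λ _ → AllP.map⁺ (All.universal (λ _ → suc i , r) xs)) xs)

allArcs-apart : ∀ n → AllPairs (Apart (Apart _≢_)) (allArcs n)
allArcs-apart n =
  allFunsTo-apart {R = Apart _≢_} (allFunsTo-apart {R = _≢_} (((λ ()) ∷ []) ∷ [] ∷ []) n) n

Matrix : Set
Matrix = Vec (Vec Bool 3) 3

infix 30 _[_,_]
_[_,_] : Matrix → Fin 3 → Fin 3 → Bool
M [ i , j ] = lookup (lookup M i) j

matrix : (Fin 3 → Fin 3 → Bool) → Matrix
matrix f = tabulate λ i → tabulate (f i)

matrix-entry : ∀ f i j → matrix f [ i , j ] ≡ f i j
matrix-entry f i j = begin
  lookup (lookup (matrix f) i) j  ≡⟨ cong (λ row → lookup row j) (lookup∘tabulate (tabulate ∘ f) i) ⟩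
  lookup (tabulate (f i)) j       ≡⟨ lookup∘tabulate (f i) j ⟩
  f i j                           ∎
  where open ≡-Reasoning

matrix-injective : ∀ {f g} → matrix f ≡ matrix g → ∀ i j → f i j ≡ g i j
matrix-injective {f} {g} eq i j =
  trans (sym (matrix-entry f i j)) (trans (cong (_[ i , j ]) eq) (matrix-entry g i j))

allVecs : ∀ {A : Set} → List A → (n : ℕ) → List (Vec A n)
allVecs xs zero    = [] ∷ []
allVecs xs (suc n) = concatMap (λ v → map (_∷ v) xs) (allVecs xs n)

∈-allVecs : ∀ {A : Set} {xs : List A} → (∀ a → a ∈ xs) → ∀ {n} (v : Vec A n) → v ∈ allVecs xs n
∈-allVecs all∈ []      = here refl
∈-allVecs {xs = xs} all∈ (a ∷ v) =
  ∈-concatMap⁺ (λ w → map (_∷ w) xs)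
    (Any.map (λ { refl → ∈-map⁺ (_∷ v) (all∈ a) }) (∈-allVecs all∈ v))

allMatrices : List Matrix
allMatrices = allVecs (allVecs (true ∷ false ∷ []) 3) 3

∈-allMatrices : ∀ M → M ∈ allMatrices
∈-allMatrices = ∈-allVecs (∈-allVecs {xs = true ∷ false ∷ []} λ where
  true  → here refl
  false → there (here refl))

before : Fin 3 → Fin 3 → Bool
before i k = toℕ i <ᵇ toℕ k

noFullLine : Matrix → Bool
noFullLine e = ∀ᵇ λ i →
  (e [ i , 0F ] ⇒ᵇ (e [ i , 1F ] ⇒ᵇ not (e [ i , 2F ]))) ∧
  (e [ 0F , i ] ⇒ᵇ (e [ 1F , i ] ⇒ᵇ not (e [ 2F , i ])))

monotonePattern : Matrix → Matrix → Bool
monotonePattern e c =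
  (∀ᵇ λ i → ∀ᵇ λ j → c [ i , j ] ⇒ᵇ e [ i , j ]) ∧
  (∀ᵇ λ i → ∀ᵇ λ k → ∀ᵇ λ j → before i k ⇒ᵇ
     ((e [ i , j ] ⇒ᵇ (e [ k , j ] ⇒ᵇ (c [ k , j ] ⇒ᵇ c [ i , j ]))) ∧
      (e [ j , i ] ⇒ᵇ (e [ j , k ] ⇒ᵇ (c [ j , i ] ⇒ᵇ c [ j , k ])))))

patterns : Matrix → List Matrix
patterns e = filter (λ c → T? (monotonePattern e c)) allMatrices

fewPatterns : Matrix → Bool
fewPatterns e = noFullLine e ⇒ᵇ (length (patterns e) ≤ᵇ 15)

census : All (T ∘ fewPatterns) allMatrices
census = AllP.all⁺ fewPatterns allMatrices tt

patterns≤15 : ∀ E → T (noFullLine E) → length (patterns E) ≤ 15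
patterns≤15 E noFull =
  ≤ᵇ⇒≤ (length (patterns E)) 15
    (⇒ᵇ-elim {noFullLine E} (All.lookup census (∈-allMatrices E)) noFull)

noFullLine-intro : ∀ {E} →
  (∀ i → T (E i 0F) → T (E i 1F) → ¬ T (E i 2F)) →
  (∀ j → T (E 0F j) → T (E 1F j) → ¬ T (E 2F j)) →
  T (noFullLine (matrix E))
noFullLine-intro {E} row col = ∀ᵇ-intro λ i → from T-∧ (row′ i , col′ i)
  where
  row′ : ∀ i → T (matrix E [ i , 0F ] ⇒ᵇ (matrix E [ i , 1F ] ⇒ᵇ not (matrix E [ i , 2F ])))
  row′ i rewrite matrix-entry E i 0F | matrix-entry E i 1F | matrix-entry E i 2F =
    ⇒ᵇ-intro λ e₀ → ⇒ᵇ-intro λ e₁ → not-intro (row i e₀ e₁)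
  col′ : ∀ j → T (matrix E [ 0F , j ] ⇒ᵇ (matrix E [ 1F , j ] ⇒ᵇ not (matrix E [ 2F , j ])))
  col′ j rewrite matrix-entry E 0F j | matrix-entry E 1F j | matrix-entry E 2F j =
    ⇒ᵇ-intro λ e₀ → ⇒ᵇ-intro λ e₁ → not-intro (col j e₀ e₁)

record MonotonePattern (E C : Fin 3 → Fin 3 → Bool) : Set where
  field
    arcs⊆edges   : ∀ i j → T (C i j) → T (E i j)
    down-columns : ∀ i k j → T (before i k) → T (E i j) → T (E k j) → T (C k j) → T (C i j)
    along-rows   : ∀ i k j → T (before i k) → T (E j i) → T (E j k) → T (C j i) → T (C j k)

monotonePattern-intro : ∀ {E C} → MonotonePattern E C → T (monotonePattern (matrix E) (matrix C))
monotonePattern-intro {E} {C} m = from T-∧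
  ( (∀ᵇ-intro λ i → ∀ᵇ-intro λ j → contained i j)
  , (∀ᵇ-intro λ i → ∀ᵇ-intro λ k → ∀ᵇ-intro λ j → ⇒ᵇ-intro λ i<k →
       from T-∧ (column i k j i<k , row i k j i<k)))
  where
  open MonotonePattern m
  contained : ∀ i j → T (matrix C [ i , j ] ⇒ᵇ matrix E [ i , j ])
  contained i j rewrite matrix-entry C i j | matrix-entry E i j = ⇒ᵇ-intro (arcs⊆edges i j)
  column : ∀ i k j → T (before i k) →
    T (matrix E [ i , j ] ⇒ᵇ (matrix E [ k , j ] ⇒ᵇ (matrix C [ k , j ] ⇒ᵇ matrix C [ i , j ])))
  column i k j i<k
    rewrite matrix-entry E i j | matrix-entry E k j | matrix-entry C k j | matrix-entry C i j =
    ⇒ᵇ-intro λ eij → ⇒ᵇ-intro λ ekj → ⇒ᵇ-intro (down-columns i k j i<k eij ekj)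
  row : ∀ i k j → T (before i k) →
    T (matrix E [ j , i ] ⇒ᵇ (matrix E [ j , k ] ⇒ᵇ (matrix C [ j , i ] ⇒ᵇ matrix C [ j , k ])))
  row i k j i<k
    rewrite matrix-entry E j i | matrix-entry E j k | matrix-entry C j i | matrix-entry C j k =
    ⇒ᵇ-intro λ eji → ⇒ᵇ-intro λ ejk → ⇒ᵇ-intro (along-rows i k j i<k eji ejk)

NoCyclicTriangle : ∀ {n} → Arcs n → Set
NoCyclicTriangle D = ∀ u v w → T (D u v) → T (D v w) → T (D w u) → ⊥

noCyclicTriangle : ∀ {n} {D : Arcs n} → T (not (hasCyclicTriangle D)) → NoCyclicTriangle D
noCyclicTriangle noCycle u v w uv vw wu =
  not-elim noCycle (∃ᵇ-intro u (∃ᵇ-intro v (∃ᵇ-intro w (from T-∧ (uv , from T-∧ (vw , wu))))))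

module Orientation {n} {H : EdgeSet n} {D : Arcs n} (D-orients : T (isOrientation H D)) where

  private
    clause : ∀ u v → T ((D u v ⇒ᵇ H u v) ∧ (H u v ⇒ᵇ (D u v xorᵇ D v u)))
    clause u v = ∀ᵇ-elim (∀ᵇ-elim D-orients u) v

  arc⇒edge : ∀ {u v} → T (D u v) → T (H u v)
  arc⇒edge {u} {v} = ⇒ᵇ-elim (proj₁ (to (T-∧ {D u v ⇒ᵇ H u v}) (clause u v)))

  edge⇒reversed : ∀ {u v} → T (H u v) → D v u ≡ not (D u v)
  edge⇒reversed {u} {v} = xorᵇ⇒≡not ∘ ⇒ᵇ-elim (proj₂ (to (T-∧ {D u v ⇒ᵇ H u v}) (clause u v)))

  reverse-arc : ∀ {u v} → T (H u v) → ¬ T (D u v) → T (D v u)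
  reverse-arc e ¬uv = subst T (sym (edge⇒reversed e)) (not-intro ¬uv)

  no-edge⇒no-arc : ∀ {u v} → ¬ T (H u v) → D u v ≡ false
  no-edge⇒no-arc {u} {v} ¬e with D u v in uv
  ... | false = refl
  ... | true  = ⊥-elim (¬e (arc⇒edge (from T-≡ uv)))

orientations-agree : ∀ {n} {H : EdgeSet n} {S S′ : Arcs n} →
  T (isOrientation H S) → T (isOrientation H S′) →
  (∀ {u v} → T (H u v) → S u v ≡ S′ u v ⊎ S v u ≡ S′ v u) →
  ∀ u v → S u v ≡ S′ u v
orientations-agree {H = H} {S} {S′} S-orients S′-orients agree u v = by-cases (T? (H u v))
  where
  module OS  = Orientation {H = H} {S} S-orients
  module OS′ = Orientation {H = H} {S′} S′-orients
  open ≡-Reasoning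

  by-reversal : S v u ≡ S′ v u → T (H u v) → S u v ≡ S′ u v
  by-reversal vu e = not-injective (begin
    not (S u v)   ≡⟨ sym (OS.edge⇒reversed e) ⟩
    S v u         ≡⟨ vu ⟩
    S′ v u        ≡⟨ OS′.edge⇒reversed e ⟩
    not (S′ u v)  ∎)

  by-cases : Dec (T (H u v)) → S u v ≡ S′ u v
  by-cases (no ¬e) = trans (OS.no-edge⇒no-arc ¬e) (sym (OS′.no-edge⇒no-arc ¬e))
  by-cases (yes e) with agree e
  ... | inj₁ uv = uv
  ... | inj₂ vu = by-reversal vu e

elements : ∀ {n} → Subset n → List (Fin n)
elements []          = []
elements (true ∷ A)  = zero ∷ map suc (elements A)
elements (false ∷ A) = map suc (elements A)

length-elements : ∀ {n} (A : Subset n) → length (elements A) ≡ ∣ A ∣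
length-elements []          = refl
length-elements (true ∷ A)  = cong suc (trans (length-map suc (elements A)) (length-elements A))
length-elements (false ∷ A) = trans (length-map suc (elements A)) (length-elements A)

∈-elements⁻ : ∀ {n} (A : Subset n) {u} → u ∈ elements A → T (mem A u)
∈-elements⁻ (true ∷ A)  (here refl) = tt
∈-elements⁻ (true ∷ A)  (there u∈)  with ∈-map⁻ suc u∈
... | _ , v∈ , refl = ∈-elements⁻ A v∈
∈-elements⁻ (false ∷ A) u∈ with ∈-map⁻ suc u∈
... | _ , v∈ , refl = ∈-elements⁻ A v∈

∈-elements⁺ : ∀ {n} (A : Subset n) {u} → T (mem A u) → u ∈ elements A
∈-elements⁺ (true ∷ A)  {zero}  _  = here refl
∈-elements⁺ (true ∷ A)  {suc u} u∈ = there (∈-map⁺ suc (∈-elements⁺ A u∈))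
∈-elements⁺ (false ∷ A) {suc u} u∈ = ∈-map⁺ suc (∈-elements⁺ A u∈)

elements-unique : ∀ {n} (A : Subset n) → Unique (elements A)
elements-unique []          = []
elements-unique (true ∷ A)  =
  AllP.map⁺ (All.universal (λ _ ()) _) ∷ UniqueP.map⁺ suc-injective (elements-unique A)
elements-unique (false ∷ A) = UniqueP.map⁺ suc-injective (elements-unique A)

record Triple {n} (A : Subset n) : Set where
  field
    p q r : Fin n
    p≢q   : p ≢ q
    p≢r   : p ≢ r
    q≢r   : q ≢ r
    p∈A   : T (mem A p)
    q∈A   : T (mem A q)
    r∈A   : T (mem A r)
    cover : ∀ {u} → T (mem A u) → u ≡ p ⊎ u ≡ q ⊎ u ≡ r

triple : ∀ {n} (A : Subset n) → ∣ A ∣ ≡ 3 → Triple A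
triple A ∣A∣≡3 =
  fromList (elements A) (trans (length-elements A) ∣A∣≡3) (elements-unique A)
           (∈-elements⁻ A) (∈-elements⁺ A)
  where
  fromList : ∀ xs → length xs ≡ 3 → Unique xs →
    (∀ {u} → u ∈ xs → T (mem A u)) → (∀ {u} → T (mem A u) → u ∈ xs) → Triple A
  fromList (x ∷ y ∷ z ∷ []) _ ((x≢y ∷ x≢z ∷ []) ∷ (y≢z ∷ []) ∷ [] ∷ []) sound complete = record
    { p = x ; q = y ; r = z ; p≢q = x≢y ; p≢r = x≢z ; q≢r = y≢z
    ; p∈A = sound (here refl) ; q∈A = sound (there (here refl))
    ; r∈A = sound (there (there (here refl)))
    ; cover = cover ∘ complete }
    where
    cover : ∀ {u} → u ∈ x ∷ y ∷ z ∷ [] → u ≡ x ⊎ u ≡ y ⊎ u ≡ z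
    cover (here u≡x)                 = inj₁ u≡x
    cover (there (here u≡y))         = inj₂ (inj₁ u≡y)
    cover (there (there (here u≡z))) = inj₂ (inj₂ u≡z)
  fromList []                  () _ _ _
  fromList (_ ∷ [])            () _ _ _
  fromList (_ ∷ _ ∷ [])        () _ _ _
  fromList (_ ∷ _ ∷ _ ∷ _ ∷ _) () _ _ _

module _ {n} {A : Subset n} where

  swap₁₂ : Triple A → Triple A
  swap₁₂ t = record
    { p = q ; q = p ; r = r ; p≢q = p≢q ∘ sym ; p≢r = q≢r ; q≢r = p≢r
    ; p∈A = q∈A ; q∈A = p∈A ; r∈A = r∈A ; cover = reorder ∘ cover }
    where
    open Triple t
    reorder : ∀ {u} → u ≡ p ⊎ u ≡ q ⊎ u ≡ r → u ≡ q ⊎ u ≡ p ⊎ u ≡ r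
    reorder (inj₁ u≡p)        = inj₂ (inj₁ u≡p)
    reorder (inj₂ (inj₁ u≡q)) = inj₁ u≡q
    reorder (inj₂ (inj₂ u≡r)) = inj₂ (inj₂ u≡r)

  rotate : Triple A → Triple A
  rotate t = record
    { p = q ; q = r ; r = p ; p≢q = q≢r ; p≢r = p≢q ∘ sym ; q≢r = p≢r ∘ sym
    ; p∈A = q∈A ; q∈A = r∈A ; r∈A = p∈A ; cover = reorder ∘ cover }
    where
    open Triple t
    reorder : ∀ {u} → u ≡ p ⊎ u ≡ q ⊎ u ≡ r → u ≡ q ⊎ u ≡ r ⊎ u ≡ p
    reorder (inj₁ u≡p)        = inj₂ (inj₂ u≡p)
    reorder (inj₂ (inj₁ u≡q)) = inj₁ u≡q
    reorder (inj₂ (inj₂ u≡r)) = inj₂ (inj₁ u≡r)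

  Tournament : Arcs n → Set
  Tournament D = ∀ {u v} → T (mem A u) → T (mem A v) → u ≢ v → ¬ T (D u v) → T (D v u)

  record Ordered (D : Arcs n) (t : Triple A) : Set where
    constructor transitive
    field
      p→q : T (D (Triple.p t) (Triple.q t))
      p→r : T (D (Triple.p t) (Triple.r t))
      q→r : T (D (Triple.q t) (Triple.r t))

  order : ∀ {D} → Tournament D → NoCyclicTriangle D → Triple A → Σ (Triple A) (Ordered D)
  order {D} tournament acyclic t = by-cases (T? (D p q)) (T? (D q r)) (T? (D p r))
    where
    open Triple t
    qp = tournament p∈A q∈A p≢q
    rq = tournament q∈A r∈A q≢r
    rp = tournament p∈A r∈A p≢r
    by-cases : Dec (T (D p q)) → Dec (T (D q r)) → Dec (T (D p r)) → Σ (Triple A) (Ordered D)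
    by-cases (yes pq) (yes qr) (yes pr) = t , transitive pq pr qr
    by-cases (yes pq) (yes qr) (no ¬pr) = ⊥-elim (acyclic p q r pq qr (rp ¬pr))
    by-cases (yes pq) (no ¬qr) (yes pr) = swap₁₂ (rotate (rotate t)) , transitive pr pq (rq ¬qr)
    by-cases (yes pq) (no ¬qr) (no ¬pr) = rotate (rotate t) , transitive (rp ¬pr) (rq ¬qr) pq
    by-cases (no ¬pq) (yes qr) (yes pr) = swap₁₂ t , transitive (qp ¬pq) qr pr
    by-cases (no ¬pq) (yes qr) (no ¬pr) = rotate t , transitive qr (qp ¬pq) (rp ¬pr)
    by-cases (no ¬pq) (no ¬qr) (yes pr) = ⊥-elim (acyclic p r q pr (rq ¬qr) (qp ¬pq))
    by-cases (no ¬pq) (no ¬qr) (no ¬pr) = swap₁₂ (rotate t) , transitive (rq ¬qr) (rp ¬pr) (qp ¬pq)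

  vertex : Triple A → Fin 3 → Fin n
  vertex t 0F = Triple.p t
  vertex t 1F = Triple.q t
  vertex t 2F = Triple.r t

  vertex-∈ : ∀ t i → T (mem A (vertex t i))
  vertex-∈ t 0F = Triple.p∈A t
  vertex-∈ t 1F = Triple.q∈A t
  vertex-∈ t 2F = Triple.r∈A t

  vertex-onto : ∀ t {u} → T (mem A u) → ∃ λ i → vertex t i ≡ u
  vertex-onto t u∈A with Triple.cover t u∈A
  ... | inj₁ u≡p        = 0F , sym u≡p
  ... | inj₂ (inj₁ u≡q) = 1F , sym u≡q
  ... | inj₂ (inj₂ u≡r) = 2F , sym u≡r

  ordered-before : ∀ {D t} → Ordered D t → ∀ i k → T (before i k) → T (D (vertex t i) (vertex t k))
  ordered-before (transitive pq pr qr) 0F 1F _ = pq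
  ordered-before (transitive pq pr qr) 0F 2F _ = pr
  ordered-before (transitive pq pr qr) 1F 2F _ = qr
  ordered-before _ 0F 0F ()
  ordered-before _ 1F 0F ()
  ordered-before _ 1F 1F ()
  ordered-before _ 2F 0F ()
  ordered-before _ 2F 1F ()
  ordered-before _ 2F 2F ()

module _ {n} (G : Graph n) where

  Adj-sym : ∀ {u v} → Adj G u v → Adj G v u
  Adj-sym {u} {v} = trans (Graph.sym G v u)

  clique⇒Adj : ∀ {C u v} → IsClique G C → T (mem C u) → T (mem C v) → u ≢ v → Adj G u v
  clique⇒Adj {C} {u} {v} C-clique u∈ v∈ =
    C-clique u v (lookup⇒[]= u C (to T-≡ u∈)) (lookup⇒[]= v C (to T-≡ v∈))

  triangle : ∀ {C} → IsClique G C → (t : Triple C) → let open Triple t in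
    Adj G p q × Adj G p r × Adj G q r
  triangle C-clique t =
    clique⇒Adj C-clique p∈A q∈A p≢q ,
    clique⇒Adj C-clique p∈A r∈A p≢r ,
    clique⇒Adj C-clique q∈A r∈A q≢r
    where open Triple t

  module _ (A B : Subset n) {u v : Fin n} where

    inside⁺ˡ : T (adj G u v) → T (mem A u) → T (mem A v) → T (inside G A B u v)
    inside⁺ˡ e u∈ v∈ = from T-∧ (e , from T-∨ (inj₁ (from T-∧ (u∈ , v∈))))

    inside⁺ʳ : T (adj G u v) → T (mem B u) → T (mem B v) → T (inside G A B u v)
    inside⁺ʳ e u∈ v∈ = from T-∧ (e , from T-∨ (inj₂ (from T-∧ (u∈ , v∈))))

    between⁺ : T (adj G u v) → T (mem A u) → T (mem B v) → T (between G A B u v)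
    between⁺ e u∈ v∈ = from T-∧ (e , from T-∨ (inj₁ (from T-∧ (u∈ , v∈))))

    between⁻ : T (between G A B u v) →
      T (adj G u v) × (T (mem A u) × T (mem B v) ⊎ T (mem B u) × T (mem A v))
    between⁻ uv with to (T-∧ {adj G u v}) uv
    ... | e , side with to (T-∨ {mem A u ∧ mem B v}) side
    ...   | inj₁ AB = e , inj₁ (to T-∧ AB)
    ...   | inj₂ BA = e , inj₂ (to T-∧ BA)

module ForOrientation {n} (G : Graph n) (A B : Subset n) (K4-free : K4Free G)
  (A-clique : IsClique G A) (∣A∣≡3 : ∣ A ∣ ≡ 3) (B-clique : IsClique G B) (∣B∣≡3 : ∣ B ∣ ≡ 3)
  (O : Arcs n) (O∈𝒟 : T (inD (inside G A B) O)) where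

  H : EdgeSet n
  H = between G A B

  O-orients : T (isOrientation (inside G A B) O)
  O-orients = proj₁ (to (T-∧ {isOrientation (inside G A B) O}) O∈𝒟)

  module O-orientation = Orientation {H = inside G A B} {O} O-orients

  O-acyclic : NoCyclicTriangle O
  O-acyclic = noCyclicTriangle (proj₂ (to (T-∧ {isOrientation (inside G A B) O}) O∈𝒟))

  clique-tournament : ∀ {C} → IsClique G C →
    (∀ {u v} → T (adj G u v) → T (mem C u) → T (mem C v) → T (inside G A B u v)) →
    Tournament {A = C} O
  clique-tournament C-clique inside-C u∈ v∈ u≢v =
    O-orientation.reverse-arc (inside-C (from T-≡ (clique⇒Adj G C-clique u∈ v∈ u≢v)) u∈ v∈)

  tA : Σ (Triple A) (Ordered O)
  tA = order (clique-tournament A-clique (inside⁺ˡ G A B)) O-acyclic (triple A ∣A∣≡3)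

  tB : Σ (Triple B) (Ordered O)
  tB = order (clique-tournament B-clique (inside⁺ʳ G A B)) O-acyclic (triple B ∣B∣≡3)

  a b : Fin 3 → Fin n
  a = vertex (proj₁ tA)
  b = vertex (proj₁ tB)

  edges : Fin 3 → Fin 3 → Bool
  edges i j = adj G (a i) (b j)

  arcs : Arcs n → Fin 3 → Fin 3 → Bool
  arcs S i j = S (a i) (b j)

  edges-noFullLine : T (noFullLine (matrix edges))
  edges-noFullLine = noFullLine-intro {edges}
    (λ i e₀ e₁ e₂ → K4-free (a i) (b 0F) (b 1F) (b 2F)
       (to T-≡ e₀ , to T-≡ e₁ , to T-≡ e₂ , triangle G B-clique (proj₁ tB)))
    (λ j e₀ e₁ e₂ → K4-free (b j) (a 0F) (a 1F) (a 2F)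
       ( Adj-sym G (to T-≡ e₀) , Adj-sym G (to T-≡ e₁) , Adj-sym G (to T-≡ e₂)
       , triangle G A-clique (proj₁ tA)))

  module _ {S : Arcs n} (S∈𝒟 : T (inD H S)) (S-compatible : T (compatible S O)) where

    private
      S-orients : T (isOrientation H S)
      S-orients = proj₁ (to (T-∧ {isOrientation H S}) S∈𝒟)

      module S-orientation = Orientation {H = H} {S} S-orients

      S∪O-acyclic : NoCyclicTriangle (S ∪ᵃ O)
      S∪O-acyclic = noCyclicTriangle S-compatible

      viaS : ∀ {u v} → T (S u v) → T ((S ∪ᵃ O) u v)
      viaS = from T-∨ ∘ inj₁

      viaO : ∀ {u v} → T (O u v) → T ((S ∪ᵃ O) u v)
      viaO = from T-∨ ∘ inj₂

      reversed : ∀ i j → T (edges i j) → ¬ T (S (a i) (b j)) → T (S (b j) (a i))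
      reversed i j e = S-orientation.reverse-arc
        (between⁺ G A B e (vertex-∈ (proj₁ tA) i) (vertex-∈ (proj₁ tB) j))

    arcs-monotone : MonotonePattern edges (arcs S)
    arcs-monotone = record
      { arcs⊆edges   = λ i j → proj₁ ∘ between⁻ G A B ∘ S-orientation.arc⇒edge
      ; down-columns = λ i k j i<k eij ekj ckj → decidable-stable (T? _) λ ¬cij →
          S∪O-acyclic (a i) (a k) (b j)
            (viaO (ordered-before (proj₂ tA) i k i<k)) (viaS ckj) (viaS (reversed i j eij ¬cij))
      ; along-rows   = λ i k j i<k eji ejk cji → decidable-stable (T? _) λ ¬cjk →
          S∪O-acyclic (a j) (b i) (b k)
            (viaS cji) (viaO (ordered-before (proj₂ tB) i k i<k)) (viaS (reversed j k ejk ¬cjk))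
      }

  arcs-injective : ∀ {S S′} → T (isOrientation H S) → T (isOrientation H S′) →
    matrix (arcs S) ≡ matrix (arcs S′) → ∀ u v → S u v ≡ S′ u v
  arcs-injective {S} {S′} S-orients S′-orients same = orientations-agree S-orients S′-orients agree
    where
    agree : ∀ {u v} → T (H u v) → S u v ≡ S′ u v ⊎ S v u ≡ S′ v u
    agree uv with proj₂ (between⁻ G A B uv)
    ... | inj₁ (u∈A , v∈B) with vertex-onto (proj₁ tA) u∈A | vertex-onto (proj₁ tB) v∈B
    ...   | i , refl | j , refl = inj₁ (matrix-injective {arcs S} {arcs S′} same i j)
    agree uv | inj₂ (u∈B , v∈A) with vertex-onto (proj₁ tA) v∈A | vertex-onto (proj₁ tB) u∈B
    ...   | i , refl | j , refl = inj₂ (matrix-injective {arcs S} {arcs S′} same i j)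

  orientation? : (S : Arcs n) → Dec (T (inD H S))
  orientation? S = T? (inD H S)

  compatible? : (S : Arcs n) → Dec (T (compatible S O))
  compatible? S = T? (compatible S O)

  compatibles : List (Arcs n)
  compatibles = filter compatible? (𝒟 H)

  Good : Arcs n → Set
  Good S = T (inD H S) × T (compatible S O)

  compatibles-good : All Good compatibles
  compatibles-good = All.zip
    ( AllP.filter⁺ compatible? (AllP.all-filter orientation? (allArcs n))
    , AllP.all-filter compatible? (𝒟 H))

  patterns-unique : Unique (map (matrix ∘ arcs) compatibles)
  patterns-unique = AllPairsP.map⁺ (AllPairs-restrict distinct compatibles-good
    (AllPairsP.filter⁺ compatible? (AllPairsP.filter⁺ orientation? (allArcs-apart n))))
    where
    orients : ∀ {S} → T (inD H S) → T (isOrientation H S)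
    orients {S} = proj₁ ∘ to (T-∧ {isOrientation H S})
    distinct : ∀ {S S′} → Good S → Good S′ → Apart (Apart _≢_) S S′ →
               matrix (arcs S) ≢ matrix (arcs S′)
    distinct (S∈𝒟 , _) (S′∈𝒟 , _) (u , v , Suv≢S′uv) same =
      Suv≢S′uv (arcs-injective (orients S∈𝒟) (orients S′∈𝒟) same u v)

  patterns-complete : map (matrix ∘ arcs) compatibles ⊆ patterns (matrix edges)
  patterns-complete M∈ with ∈-map⁻ (matrix ∘ arcs) M∈
  ... | S , S∈ , refl = ∈-filter⁺ (λ c → T? (monotonePattern (matrix edges) c)) (∈-allMatrices _)
    (monotonePattern-intro {edges} (arcs-monotone S∈𝒟 S-compatible))
    where
    S∈𝒟 = proj₁ (All.lookup compatibles-good S∈)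
    S-compatible = proj₂ (All.lookup compatibles-good S∈)

  numCompatible≤15 : numCompatible G A B O ≤ 15
  numCompatible≤15 = begin
    length compatibles                        ≡⟨ sym (length-map (matrix ∘ arcs) compatibles) ⟩
    length (map (matrix ∘ arcs) compatibles)
      ≤⟨ Unique-⊆⇒length≤ patterns-unique patterns-complete ⟩
    length (patterns (matrix edges))          ≤⟨ patterns≤15 (matrix edges) edges-noFullLine ⟩
    15                                        ∎
    where open ≤-Reasoning

lemma2p9 : (n : ℕ) (G : Graph n) (A B : Subset n) →
    K4Free G →
    IsClique G A → ∣ A ∣ ≡ 3 →
    IsClique G B → ∣ B ∣ ≡ 3 →
    Disjoint A B →
    ext G A B ≤ 15
lemma2p9 n G A B K4-free A-clique ∣A∣≡3 B-clique ∣B∣≡3 _ =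
  foldr-preservesᵇ {P = _≤ 15} ⊔-lub z≤n (AllP.map⁺ (All.map
    (ForOrientation.numCompatible≤15 G A B K4-free A-clique ∣A∣≡3 B-clique ∣B∣≡3 _)
    (AllP.all-filter (λ O → T? (inD (inside G A B) O)) (allArcs n))))
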